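{- Let $n\geq 2$ and $t\geq 1$ be integers. The complete multipartite graph $K_{n\times t}$ (the strongly regular graph with parameters $(nt,(n-1)t,(n-2)t,(n-1)t)$ and smallest eigenvalue $-t$) is integrable; that is, there is an integral matrix $N$ with $N^TN=A(K_{n\times t})+tI$.
   Context: $K_{n\times t}$ is the graph whose vertex set is partitioned into $n$ classes of size $t$, two vertices being adjacent iff they lie in different classes. $A(\cdot)$ denotes the adjacency matrix. A graph $G$ with smallest eigenvalue $\theta_{\min}(G)$ is integrable if there is an integral matrix $N$ with $A(G)-\lfloor\theta_{\min}(G)\rfloor I=N^TN$. -}

module Defs where

open import Data.Nat using (ℕ; zero; suc)
open import Data.Fin using (Fin; zero; suc; _≟_)
open import Data.Product using (_×_; _,_)
open import Data.Integer using (ℤ; _+_; _*_; +_)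
open import Relation.Nullary using (yes; no)

sumFin : (m : ℕ) → (Fin m → ℤ) → ℤ
sumFin zero    f = + 0
sumFin (suc m) f = f zero + sumFin m (λ i → f (suc i))

Vertex : ℕ → ℕ → Set
Vertex n t = Fin n × Fin t

adjK : (n t : ℕ) → Vertex n t → Vertex n t → ℤ
adjK n t (i , a) (j , b) with i ≟ j
... | yes _ = + 0
... | no  _ = + 1

idMat : (n t : ℕ) → Vertex n t → Vertex n t → ℤ
idMat n t (i , a) (j , b) with i ≟ j | a ≟ b
... | yes _ | yes _ = + 1
... | _     | _     = + 0

gram : {V : Set} (m : ℕ) → (Fin m → V → ℤ) → V → V → ℤ
gram m N u v = sumFin m (λ k → N k u * N k v)

-- A + tI for K_{n×t} is J + (tI − J) ⊕ ⋯ ⊕ (tI − J), where each block tI − J on a class of size t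
-- is the Laplacian of the complete graph K_t and hence the Gram matrix of its oriented edge–vertex
-- incidence matrix. Stacking an all-ones row on top of the block-diagonal sum of n copies of that
-- incidence matrix therefore gives an integral N with NᵀN = A + tI.
module Submission where

open import Defs
open import Data.Nat using (ℕ; _≤_; zero; suc)
import Data.Nat as ℕ
open import Data.Fin using (Fin; zero; suc; splitAt; _≟_)
open import Data.Product using (Σ; _×_; _,_)
open import Data.Sum using (inj₁; inj₂)
open import Data.Integer using (ℤ; _+_; _*_; +_; -1ℤ)
open import Data.Integer.Properties
  using (+-identityˡ; +-identityʳ; +-assoc; +-commutativeSemigroup; *-identityˡ; *-identityʳ; *-zeroʳ; *-comm; suc-*)
open import Data.Vec.Functional using (_++_)
open import Relation.Binary.PropositionalEquality using (_≡_; _≢_; refl; sym; trans; cong; cong₂; module ≡-Reasoning)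
open import Relation.Nullary using (yes; no)
open import Data.Empty using (⊥-elim)
open import Algebra.Properties.CommutativeSemigroup +-commutativeSemigroup using (x∙yz≈y∙xz)

open ≡-Reasoning

Matrix : ℕ → Set → Set
Matrix m V = Fin m → V → ℤ

private
  variable
    m m′ n t : ℕ
    V X : Set

sumFin-cong : {f g : Fin m → ℤ} → (∀ k → f k ≡ g k) → sumFin m f ≡ sumFin m g
sumFin-cong {zero}  f≗g = refl
sumFin-cong {suc m} f≗g = cong₂ _+_ (f≗g zero) (sumFin-cong (λ k → f≗g (suc k)))

sumFin-zero : {f : Fin m → ℤ} → (∀ k → f k ≡ + 0) → sumFin m f ≡ + 0
sumFin-zero {zero}  f≗0 = refl
sumFin-zero {suc m} f≗0 = cong₂ _+_ (f≗0 zero) (sumFin-zero (λ k → f≗0 (suc k)))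

sumFin-const : (m : ℕ) (c : ℤ) → sumFin m (λ _ → c) ≡ + m * c
sumFin-const zero    c = refl
sumFin-const (suc m) c = begin
  c + sumFin m (λ _ → c)  ≡⟨ cong (_+_ c) (sumFin-const m c) ⟩
  c + + m * c             ≡⟨ suc-* (+ m) c ⟨
  + suc m * c             ∎

++-suc : (f : Fin (suc m) → X) (g : Fin m′ → X) (k : Fin (m ℕ.+ m′)) →
         (f ++ g) (suc k) ≡ ((λ i → f (suc i)) ++ g) k
++-suc {m = m} f g k with splitAt m k
... | inj₁ i = refl
... | inj₂ j = refl

sumFin-++ : (f : Fin m → ℤ) (g : Fin m′ → ℤ) → sumFin (m ℕ.+ m′) (f ++ g) ≡ sumFin m f + sumFin m′ g
sumFin-++ {zero}  f g = sym (+-identityˡ _)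
sumFin-++ {suc m} {m′} f g = begin
  f zero + sumFin (m ℕ.+ m′) (λ k → (f ++ g) (suc k))
    ≡⟨ cong (_+_ (f zero)) (sumFin-cong (++-suc f g)) ⟩
  f zero + sumFin (m ℕ.+ m′) ((λ i → f (suc i)) ++ g)
    ≡⟨ cong (_+_ (f zero)) (sumFin-++ (λ i → f (suc i)) g) ⟩
  f zero + (sumFin m (λ i → f (suc i)) + sumFin m′ g)
    ≡⟨ +-assoc (f zero) _ _ ⟨
  sumFin (suc m) f + sumFin m′ g
    ∎

gram-++ : (M : Matrix m V) (M′ : Matrix m′ V) (u v : V) →
          gram (m ℕ.+ m′) (M ++ M′) u v ≡ gram m M u v + gram m′ M′ u v
gram-++ {m = m} M M′ u v = begin
  gram _ (M ++ M′) u v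
    ≡⟨ sumFin-cong termwise ⟩
  sumFin _ ((λ k → M k u * M k v) ++ (λ k → M′ k u * M′ k v))
    ≡⟨ sumFin-++ (λ k → M k u * M k v) (λ k → M′ k u * M′ k v) ⟩
  gram _ M u v + gram _ M′ u v
    ∎
  where
  termwise : ∀ k → (M ++ M′) k u * (M ++ M′) k v ≡ ((λ i → M i u * M i v) ++ (λ j → M′ j u * M′ j v)) k
  termwise k with splitAt m k
  ... | inj₁ i = refl
  ... | inj₂ j = refl

gram-zeroˡ : (M : Matrix m V) (u v : V) → (∀ k → M k u ≡ + 0) → gram m M u v ≡ + 0
gram-zeroˡ M u v Mu≡0 = sumFin-zero (λ k → cong (_* M k v) (Mu≡0 k))

gram-zeroʳ : (M : Matrix m V) (u v : V) → (∀ k → M k v ≡ + 0) → gram m M u v ≡ + 0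
gram-zeroʳ M u v Mv≡0 = sumFin-zero (λ k → trans (cong (M k u *_) (Mv≡0 k)) (*-zeroʳ (M k u)))

δ : Fin n → Fin n → ℤ
δ zero    zero    = + 1
δ zero    (suc b) = + 0
δ (suc a) zero    = + 0
δ (suc a) (suc b) = δ a b

δ-refl : (a : Fin n) → δ a a ≡ + 1
δ-refl zero    = refl
δ-refl (suc a) = δ-refl a

δ-≢ : {a b : Fin n} → a ≢ b → δ a b ≡ + 0
δ-≢ {a = zero}  {zero}  a≢b = ⊥-elim (a≢b refl)
δ-≢ {a = zero}  {suc b} a≢b = refl
δ-≢ {a = suc a} {zero}  a≢b = refl
δ-≢ {a = suc a} {suc b} a≢b = δ-≢ (λ a≡b → a≢b (cong suc a≡b))

sumFin-δ : (a : Fin n) (f : Fin n → ℤ) → sumFin n (λ q → δ q a * f q) ≡ f a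
sumFin-δ {suc n} zero f = begin
  + 1 * f zero + sumFin n (λ q → + 0)  ≡⟨ cong₂ _+_ (*-identityˡ (f zero)) (sumFin-zero {n} (λ _ → refl)) ⟩
  f zero + + 0                          ≡⟨ +-identityʳ (f zero) ⟩
  f zero                                ∎
sumFin-δ {suc n} (suc a) f = trans (+-identityˡ _) (sumFin-δ a (λ q → f (suc q)))

pairs : ℕ → ℕ
pairs zero    = 0
pairs (suc t) = t ℕ.+ pairs t

-- Row q is the edge {0, q + 1} of K_{t+1}, oriented as e_{q+1} − e_0.
star : (t : ℕ) → Matrix t (Fin (suc t))
star t q zero    = -1ℤ
star t q (suc a) = δ q a

shift : (Fin t → ℤ) → Fin (suc t) → ℤ
shift r zero    = + 0
shift r (suc a) = r a

incidence : (t : ℕ) → Matrix (pairs t) (Fin t)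
incidence (suc t) = star t ++ (λ k → shift (incidence t k))

gram-incidence : (t : ℕ) (a b : Fin t) → + 1 + gram (pairs t) (incidence t) a b ≡ + t * δ a b
gram-incidence (suc t) a b = begin
  + 1 + gram _ (incidence (suc t)) a b  ≡⟨ cong (_+_ (+ 1)) (gram-++ (star t) shifted a b) ⟩
  + 1 + (gram t (star t) a b + gram (pairs t) shifted a b)  ≡⟨ blockwise a b ⟩
  + suc t * δ a b                       ∎
  where
  shifted : Matrix (pairs t) (Fin (suc t))
  shifted k = shift (incidence t k)

  blockwise : (a b : Fin (suc t)) →
              + 1 + (gram t (star t) a b + gram (pairs t) shifted a b) ≡ + suc t * δ a b
  blockwise zero zero = begin
    + 1 + (sumFin t (λ _ → + 1) + gram (pairs t) shifted zero zero)
      ≡⟨ cong₂ (λ x y → + 1 + (x + y)) (sumFin-const t (+ 1)) (gram-zeroˡ shifted zero zero (λ _ → refl)) ⟩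
    + 1 + (+ t * + 1 + + 0)   ≡⟨ cong (_+_ (+ 1)) (trans (+-identityʳ _) (*-identityʳ (+ t))) ⟩
    + suc t                   ≡⟨ *-identityʳ (+ suc t) ⟨
    + suc t * + 1             ∎
  blockwise zero (suc b) = begin
    + 1 + (sumFin t (λ q → -1ℤ * δ q b) + gram (pairs t) shifted zero (suc b))
      ≡⟨ cong₂ (λ x y → + 1 + (x + y))
               (trans (sumFin-cong (λ q → *-comm -1ℤ (δ q b))) (sumFin-δ b (λ _ → -1ℤ)))
               (gram-zeroˡ shifted zero (suc b) (λ _ → refl)) ⟩
    + 0                       ≡⟨ *-zeroʳ (+ suc t) ⟨
    + suc t * + 0             ∎
  blockwise (suc a) zero = begin
    + 1 + (sumFin t (λ q → δ q a * -1ℤ) + gram (pairs t) shifted (suc a) zero)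
      ≡⟨ cong₂ (λ x y → + 1 + (x + y)) (sumFin-δ a (λ _ → -1ℤ)) (gram-zeroʳ shifted (suc a) zero (λ _ → refl)) ⟩
    + 0                       ≡⟨ *-zeroʳ (+ suc t) ⟨
    + suc t * + 0             ∎
  blockwise (suc a) (suc b) = begin
    + 1 + (sumFin t (λ q → δ q a * δ q b) + gram (pairs t) (incidence t) a b)
      ≡⟨ cong (λ x → + 1 + (x + gram (pairs t) (incidence t) a b)) (sumFin-δ a (λ q → δ q b)) ⟩
    + 1 + (δ a b + gram (pairs t) (incidence t) a b)
      ≡⟨ x∙yz≈y∙xz (+ 1) (δ a b) _ ⟩
    δ a b + (+ 1 + gram (pairs t) (incidence t) a b)
      ≡⟨ cong (_+_ (δ a b)) (gram-incidence t a b) ⟩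
    δ a b + + t * δ a b       ≡⟨ suc-* (+ t) (δ a b) ⟨
    + suc t * δ a b           ∎

inFirstClass : (X → ℤ) → Fin (suc n) × X → ℤ
inFirstClass r (zero  , x) = r x
inFirstClass r (suc i , x) = + 0

inLaterClasses : (Fin n × X → ℤ) → Fin (suc n) × X → ℤ
inLaterClasses r (zero  , x) = + 0
inLaterClasses r (suc i , x) = r (i , x)

blockDiag : (n : ℕ) → Matrix m X → Matrix (n ℕ.* m) (Fin n × X)
blockDiag (suc n) M = (λ k → inFirstClass (M k)) ++ (λ k → inLaterClasses (blockDiag n M k))

gram-blockDiag : (n : ℕ) (M : Matrix m X) (i j : Fin n) (x y : X) →
                 gram (n ℕ.* m) (blockDiag n M) (i , x) (j , y) ≡ δ i j * gram m M x y
gram-blockDiag {m} {X} (suc n) M i j x y = begin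
  gram _ (blockDiag (suc n) M) (i , x) (j , y)       ≡⟨ gram-++ first later (i , x) (j , y) ⟩
  gram m first (i , x) (j , y) + gram (n ℕ.* m) later (i , x) (j , y)  ≡⟨ blockwise i j ⟩
  δ i j * gram m M x y                               ∎
  where
  first : Matrix m (Fin (suc n) × X)
  first k = inFirstClass (M k)

  later : Matrix (n ℕ.* m) (Fin (suc n) × X)
  later k = inLaterClasses (blockDiag n M k)

  blockwise : (i j : Fin (suc n)) →
              gram m first (i , x) (j , y) + gram (n ℕ.* m) later (i , x) (j , y) ≡ δ i j * gram m M x y
  blockwise zero zero = begin
    gram m M x y + gram (n ℕ.* m) later (zero , x) (zero , y)
      ≡⟨ cong (_+_ (gram m M x y)) (gram-zeroˡ later (zero , x) (zero , y) (λ _ → refl)) ⟩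
    gram m M x y + + 0      ≡⟨ +-identityʳ _ ⟩
    gram m M x y            ≡⟨ *-identityˡ _ ⟨
    + 1 * gram m M x y      ∎
  blockwise zero (suc j) = cong₂ _+_
    (gram-zeroʳ first (zero , x) (suc j , y) (λ _ → refl))
    (gram-zeroˡ later (zero , x) (suc j , y) (λ _ → refl))
  blockwise (suc i) zero = cong₂ _+_
    (gram-zeroˡ first (suc i , x) (zero , y) (λ _ → refl))
    (gram-zeroʳ later (suc i , x) (zero , y) (λ _ → refl))
  blockwise (suc i) (suc j) = begin
    gram m first (suc i , x) (suc j , y) + gram (n ℕ.* m) (blockDiag n M) (i , x) (j , y)
      ≡⟨ cong₂ _+_ (gram-zeroˡ first (suc i , x) (suc j , y) (λ _ → refl)) (gram-blockDiag n M i j x y) ⟩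
    + 0 + δ i j * gram m M x y  ≡⟨ +-identityˡ _ ⟩
    δ i j * gram m M x y        ∎

onesRow : Matrix 1 V
onesRow _ _ = + 1

multipartiteRoot : (n t : ℕ) → Matrix (suc (n ℕ.* pairs t)) (Vertex n t)
multipartiteRoot n t = onesRow ++ blockDiag n (incidence t)

gram-multipartiteRoot : (n t : ℕ) (i j : Fin n) (a b : Fin t) →
  gram _ (multipartiteRoot n t) (i , a) (j , b) ≡ + 1 + δ i j * gram (pairs t) (incidence t) a b
gram-multipartiteRoot n t i j a b =
  trans (gram-++ onesRow (blockDiag n (incidence t)) (i , a) (j , b))
        (cong (_+_ (+ 1)) (gram-blockDiag n (incidence t) i j a b))

gram-multipartiteRoot-sameClass : (n t : ℕ) (i : Fin n) (a b : Fin t) →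
  gram _ (multipartiteRoot n t) (i , a) (i , b) ≡ + t * δ a b
gram-multipartiteRoot-sameClass n t i a b = begin
  gram _ (multipartiteRoot n t) (i , a) (i , b)   ≡⟨ gram-multipartiteRoot n t i i a b ⟩
  + 1 + δ i i * gram (pairs t) (incidence t) a b  ≡⟨ cong (λ d → + 1 + d * gram (pairs t) (incidence t) a b) (δ-refl i) ⟩
  + 1 + + 1 * gram (pairs t) (incidence t) a b    ≡⟨ cong (_+_ (+ 1)) (*-identityˡ (gram (pairs t) (incidence t) a b)) ⟩
  + 1 + gram (pairs t) (incidence t) a b          ≡⟨ gram-incidence t a b ⟩
  + t * δ a b                                     ∎

gram-multipartiteRoot≡A+tI : (n t : ℕ) (u v : Vertex n t) →
  gram _ (multipartiteRoot n t) u v ≡ adjK n t u v + (+ t) * idMat n t u v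
gram-multipartiteRoot≡A+tI n t (i , a) (j , b) with i ≟ j | a ≟ b
... | yes refl | yes refl = begin
  gram _ (multipartiteRoot n t) (i , a) (i , a)   ≡⟨ gram-multipartiteRoot-sameClass n t i a a ⟩
  + t * δ a a                                     ≡⟨ cong (_*_ (+ t)) (δ-refl a) ⟩
  + t * + 1                                       ≡⟨ +-identityˡ (+ t * + 1) ⟨
  + 0 + + t * + 1                                 ∎
... | yes refl | no a≢b = begin
  gram _ (multipartiteRoot n t) (i , a) (i , b)   ≡⟨ gram-multipartiteRoot-sameClass n t i a b ⟩
  + t * δ a b                                     ≡⟨ cong (_*_ (+ t)) (δ-≢ a≢b) ⟩
  + t * + 0                                       ≡⟨ +-identityˡ (+ t * + 0) ⟨
  + 0 + + t * + 0                                 ∎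
... | no i≢j | _ = begin
  gram _ (multipartiteRoot n t) (i , a) (j , b)   ≡⟨ gram-multipartiteRoot n t i j a b ⟩
  + 1 + δ i j * gram (pairs t) (incidence t) a b  ≡⟨ cong (λ d → + 1 + d * gram (pairs t) (incidence t) a b) (δ-≢ i≢j) ⟩
  + 1                                             ≡⟨ cong (_+_ (+ 1)) (*-zeroʳ (+ t)) ⟨
  + 1 + + t * + 0                                 ∎

mainTheorem5 : (n t : ℕ) → 2 ≤ n → 1 ≤ t →
    Σ ℕ (λ m → Σ (Fin m → Vertex n t → ℤ) (λ N →
    (u v : Vertex n t) → gram m N u v ≡ adjK n t u v + (+ t) * idMat n t u v))
mainTheorem5 n t _ _ = _ , multipartiteRoot n t , gram-multipartiteRoot≡A+tI n t
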